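{- Let $L$ be a finite lattice of finite length with minimum $\hat0$ and maximum $\hat1$, and let $I\subset L$ be a proper ideal. Let $\mathcal{S}=\{\{x,y\}\mid x\in I\setminus\{\hat0\},\ y\in\overline{L}\setminus I,\ x<y\}$, a set of edges of $\Delta(\overline{L})$. Then $\Delta(\overline{\mathrm{Bier}(L,I)})$ is isomorphic to the simplicial complex obtained from $\Delta(\overline{L})$ by performing stellar subdivisions on all edges in $\mathcal{S}$, one after another, in an order of weakly increasing length $l(x,y)$ of the interval $[x,y]$.
   Context: An ideal is a down-closed subset; proper means nonempty and not all of $L$. $\overline{P}=P\setminus\{\hat0,\hat1\}$ denotes the proper part of a bounded poset; $\Delta(P)$ is its order complex (chains as faces). $l(x,y)$ is the length (maximal number of cover relations in a chain) of the interval $[x,y]$ of $L$. $\mathrm{Bier}(L,I)$ is the bounded poset whose elements are all intervals $[x,y]\subseteq L$ with $x\in I$, $y\notin I$, together with an extra top element $\hat1$, ordered by reverse inclusion ($[x,y]\le[v,w]$ iff $x\le v<w\le y$); its minimum is $[\hat0,\hat1]$, and $\overline{\mathrm{Bier}(L,I)}$ removes $[\hat0,\hat1]$ and the extra top. The stellar subdivision of a simplicial complex $K$ at a nonempty face $F$ is the complex $\mathrm{sd}_F(K)$ with faces $\{G\in K: G\not\supseteq F\}\cup\{G\cup\{v_F\}: G\in K,\ G\not\supseteq F,\ G\cup F\in K\}$, where $v_F$ is a new vertex. -}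

module Defs where

open import Level using (0ℓ)
open import Data.Nat using (ℕ; zero; suc) renaming (_≤_ to _≤ℕ_)
open import Data.Fin using (Fin)
open import Data.Fin.Subset using (Subset; _∈_; _∉_)
open import Data.Product using (Σ; ∃; _×_; _,_)
open import Data.Sum using (_⊎_; inj₁; inj₂)
open import Data.Unit using (⊤; tt)
open import Data.List using (List; []; _∷_; _++_; map)
open import Data.List.Relation.Unary.All using (All)
open import Data.List.Relation.Unary.Linked using (Linked)
open import Data.List.Relation.Unary.Unique.Propositional using (Unique)
import Data.List.Membership.Propositional as M
open import Data.List.Relation.Binary.Subset.Propositional using (_⊆_)
open import Relation.Binary.Core using (Rel)
open import Relation.Binary.PropositionalEquality using (_≡_; _≢_)
open import Relation.Binary.Lattice.Structures using (IsBoundedLattice)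
open import Relation.Nullary using (¬_)
open import Algebra.Core using (Op₂)
open import Function using (id)

-- Finite lattices: carrier Fin n, equality ≡ (finite length is automatic)

record FinLattice (n : ℕ) : Set₁ where
  field
    _≤_ : Rel (Fin n) 0ℓ
    _∨_ : Op₂ (Fin n)
    _∧_ : Op₂ (Fin n)
    top : Fin n
    bot : Fin n
    isBoundedLattice : IsBoundedLattice _≡_ _≤_ _∨_ _∧_ top bot

  _<_ : Rel (Fin n) 0ℓ
  x < y = x ≤ y × x ≢ y

  IsProperIdeal : Subset n → Set
  IsProperIdeal I =
    (∀ x y → x ≤ y → y ∈ I → x ∈ I) × (∃ λ x → x ∈ I) × (∃ λ y → y ∉ I)

  data Chain : Fin n → Fin n → ℕ → Set where
    done : ∀ {x} → Chain x x zero
    step : ∀ {x y z k} → x < y → Chain y z k → Chain x z (suc k)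

  IntervalLength : Fin n → Fin n → ℕ → Set
  IntervalLength x y k = Chain x y k × (∀ j → Chain x y j → j ≤ℕ k)

  -- the edge set S, with {x,y} recorded as the ordered pair (x , y), x < y
  InS : Subset n → Fin n × Fin n → Set
  InS I (x , y) =
    (x ∈ I × x ≢ bot) × ((y ≢ bot × y ≢ top) × y ∉ I) × x < y

  LengthLE : Rel (Fin n × Fin n) 0ℓ
  LengthLE (x , y) (v , w) =
    ∀ k k' → IntervalLength x y k → IntervalLength v w k' → k ≤ℕ k'

-- Simplicial complexes: a vertex type and a predicate on finite vertex
-- sets (given as lists; all predicates below only depend on the
-- underlying set of a list).

record Complex : Set₁ where
  field
    Vert : Set
    Face : List Vert → Set
open Complex public

-- isomorphism: mutually inverse bijection between the vertex sets
-- (vertices = v with {v} a face), simplicial in both directions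
record _≅_ (K K' : Complex) : Set where
  field
    f : Vert K → Vert K'
    g : Vert K' → Vert K
    f-face : ∀ G → Face K G → Face K' (map f G)
    g-face : ∀ H → Face K' H → Face K (map g H)
    gf : ∀ v → Face K (v ∷ []) → g (f v) ≡ v
    fg : ∀ w → Face K' (w ∷ []) → f (g w) ≡ w

Δ : (V : Set) → (V → Set) → Rel V 0ℓ → Complex
Δ V P _≤_ = record
  { Vert = V
  ; Face = λ G → All P G × (∀ a b → a M.∈ G → b M.∈ G → (a ≤ b) ⊎ (b ≤ a)) }

lefts : {A B : Set} → List (A ⊎ B) → List A
lefts [] = []
lefts (inj₁ a ∷ xs) = a ∷ lefts xs
lefts (inj₂ _ ∷ xs) = lefts xs

-- stellar subdivision at F; the new vertex v_F is inj₂ tt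
sd : (K : Complex) → List (Vert K) → Complex
sd K F = record
  { Vert = Vert K ⊎ ⊤
  ; Face = λ H → Face K (lefts H) × ¬ (F ⊆ lefts H)
                 × (inj₂ tt M.∈ H → Face K (lefts H ++ F)) }

-- successive stellar subdivisions at edges {x,y} of the original vertices
iterSd : {V : Set} → (K : Complex) → (V → Vert K) → List (V × V) → Complex
iterSd K e [] = K
iterSd K e ((x , y) ∷ es) =
  iterSd (sd K (e x ∷ e y ∷ [])) (λ v → inj₁ (e v)) es

module _ {n : ℕ} (L : FinLattice n) where
  open FinLattice L

  ΔProper : Complex
  ΔProper = Δ (Fin n) (λ v → v ≢ bot × v ≢ top) _≤_

  -- Δ(Bier(L,I) proper part): intervals [x,y] with x ∈ I, y ∉ I, x ≤ y,
  -- excluding [0̂,1̂]; ordered by reverse inclusion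
  ΔBier : Subset n → Complex
  ΔBier I = Δ (Fin n × Fin n)
    (λ { (x , y) → x ∈ I × y ∉ I × x ≤ y × ¬ (x ≡ bot × y ≡ top) })
    (λ { (x , y) (v , w) → x ≤ v × w ≤ y })

  SubdividedΔ : List (Fin n × Fin n) → Complex
  SubdividedΔ es = iterSd ΔProper id es

-- Stellar subdivision of a flag complex at an edge {u, w} is again a flag
-- complex: the edge uw disappears and the new vertex is joined to the common
-- neighbours of u and w.  So after subdividing a set Done of edges of S, the
-- complex is the flag complex on intervals of L in which x ∈ I is [x, 1̂],
-- y ∉ I is [0̂, y], the new vertex of {x, y} is [x, y], and two intervals are
-- adjacent iff one contains the other or they form a not yet subdivided edge
-- {[x, 1̂], [0̂, y]}.  When {x, y} is subdivided after all shorter edges, no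
-- done edge contains [x, y] and every edge of S strictly inside [x, y] is
-- done; this is exactly what makes the common neighbours of [x, 1̂] and
-- [0̂, y] the intervals comparable with [x, y].  Once all of S is done,
-- adjacency is comparability, i.e. the complex is Δ of Bier(L, I).

module Submission where

open import Defs
open import Level using (0ℓ)
open import Data.Nat using (ℕ; zero; suc; _+_; z≤n; s≤s) renaming (_≤_ to _≤ℕ_; _<_ to _<ℕ_)
import Data.Nat.Properties as ℕₚ
open import Data.Fin using (Fin) renaming (_≟_ to _≟ᶠ_)
open import Data.Fin.Properties using (any?)
open import Data.Fin.Subset using (Subset; ∣_∣) renaming (_∈_ to _∈ₛ_; _∉_ to _∉ₛ_; _⊂_ to _⊂ₛ_)
open import Data.Fin.Subset.Properties using (∣p∣≤n; p⊂q⇒∣p∣<∣q∣) renaming (_∈?_ to _∈ₛ?_)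
open import Data.Vec using (tabulate)
open import Data.Vec.Properties using (lookup∘tabulate; []=⇒lookup; lookup⇒[]=)
open import Data.Bool using (true)
open import Data.Product using (∃; _×_; _,_; proj₁; proj₂)
open import Data.Product.Properties using (≡-dec)
open import Data.Sum using (_⊎_; inj₁; inj₂; [_,_])
open import Data.Unit using (⊤; tt)
open import Data.Empty using (⊥; ⊥-elim)
open import Data.List using (List; []; _∷_; _++_; map)
open import Data.List.Membership.Propositional using (_∈_; _∉_)
open import Data.List.Membership.Propositional.Properties using (∈-++⁻; ∈-++⁺ˡ; ∈-++⁺ʳ; ∈-map⁻)
open import Data.List.Relation.Unary.All as All using (All; []; _∷_)
import Data.List.Relation.Unary.All.Properties as Allₚ
open import Data.List.Relation.Unary.Any using (here; there)
open import Data.List.Relation.Unary.AllPairs as AllPairs using (AllPairs; []; _∷_)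
open import Data.List.Relation.Unary.Linked using (Linked; []; [-]; _∷_)
open import Data.List.Relation.Unary.Unique.Propositional using (Unique)
open import Data.List.Relation.Binary.Subset.Propositional using (_⊆_)
open import Relation.Binary.Core using (Rel)
open import Relation.Binary.Definitions using (Reflexive; Symmetric; DecidableEquality)
open import Relation.Binary.Lattice.Structures using (IsBoundedLattice)
open import Relation.Binary.PropositionalEquality using (_≡_; _≢_; refl; sym; trans; cong; cong₂; subst; subst₂)
open import Relation.Nullary using (¬_; Dec; yes; no; does)
open import Relation.Nullary.Decidable using (dec-true; _×-dec_)
open import Relation.Unary using (Pred; ∅; _∪_; ｛_｝)
open import Function.Bundles using (_⇔_; mk⇔; Equivalence)

-- Flag complexes and stellar subdivision of an edge

FlagFace : {V : Set} → (V → Set) → Rel V 0ℓ → List V → Set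
FlagFace P R G = All P G × (∀ a b → a ∈ G → b ∈ G → R a b)

Flag : (V : Set) → (V → Set) → Rel V 0ℓ → Complex
Flag V P R = record { Vert = V ; Face = FlagFace P R }

ModelVertex : ∀ {V W : Set} → (V → W) → (W → V) → (W → Set) → V → Set
ModelVertex f g P v = P (f v) × g (f v) ≡ v

PullbackFace : ∀ {V W : Set} → (V → W) → (W → V) → (W → Set) → Rel W 0ℓ → List V → Set
PullbackFace f g P R = FlagFace (ModelVertex f g P) (λ a b → R (f a) (f b))

-- Requiring g ∘ f = id only on faces lets K have vertices lying in no face
-- (such as 0̂ and 1̂ in Δ(L̄)).
record Models (K : Complex) {W : Set} (P : W → Set) (R : Rel W 0ℓ) : Set where
  field
    f : Vert K → W
    g : W → Vert K
    faces : ∀ H → Face K H ⇔ PullbackFace f g P R H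
    f∘g : ∀ {p} → P p → f (g p) ≡ p

  face⇒ : ∀ {H} → Face K H → PullbackFace f g P R H
  face⇒ {H} = Equivalence.to (faces H)

  face⇐ : ∀ {H} → PullbackFace f g P R H → Face K H
  face⇐ {H} = Equivalence.from (faces H)

record FlagIso {W W' : Set} (P : W → Set) (R : Rel W 0ℓ) (Q : W' → Set) (S : Rel W' 0ℓ) : Set where
  field
    to : W → W'
    from : W' → W
    to-vertex : ∀ {p} → P p ⇔ Q (to p)
    from∘to : ∀ {p} → P p → from (to p) ≡ p
    to∘from : ∀ {q} → Q q → to (from q) ≡ q
    to-edge : ∀ {a b} → P a → P b → R a b ⇔ S (to a) (to b)

flag-models : {V : Set} (P : V → Set) (R : Rel V 0ℓ) → Models (Flag V P R) P R
flag-models P R = record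
  { f = λ v → v
  ; g = λ v → v
  ; faces = λ H → mk⇔ (λ (ps , rs) → All.map (_, refl) ps , rs) (λ (ps , rs) → All.map proj₁ ps , rs)
  ; f∘g = λ _ → refl
  }

models-transport : ∀ {K W W'} {P : W → Set} {R Q S} → Models K P R → FlagIso {W} {W'} P R Q S → Models K Q S
models-transport {K} {P = P} {R} {Q} {S} M iso = record
  { f = λ v → to (f v)
  ; g = λ q → g (from q)
  ; faces = λ H → mk⇔ forward backward
  ; f∘g = λ {q} Qq → let Pq = Equivalence.from to-vertex (subst Q (sym (to∘from Qq)) Qq) in
      trans (cong to (f∘g Pq)) (to∘from Qq)
  }
  where
  open Models M
  open FlagIso iso
  forward : ∀ {H} → Face K H → PullbackFace (λ v → to (f v)) (λ q → g (from q)) Q S H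
  forward fH with face⇒ fH
  ... | ps , rs = All.map (λ (Pv , gfv) → Equivalence.to to-vertex Pv , trans (cong g (from∘to Pv)) gfv) ps
                , λ a b a∈ b∈ → Equivalence.to (to-edge (proj₁ (All.lookup ps a∈)) (proj₁ (All.lookup ps b∈)))
                                                (rs a b a∈ b∈)
  backward : ∀ {H} → PullbackFace (λ v → to (f v)) (λ q → g (from q)) Q S H → Face K H
  backward (qs , ss) = face⇐ (All.map pull qs , λ a b a∈ b∈ →
      Equivalence.from (to-edge (P-of (All.lookup qs a∈)) (P-of (All.lookup qs b∈))) (ss a b a∈ b∈))
    where
    P-of : ∀ {v} → ModelVertex (λ v → to (f v)) (λ q → g (from q)) Q v → P (f v)
    P-of (Qv , _) = Equivalence.from to-vertex Qv
    pull : ∀ {v} → ModelVertex (λ v → to (f v)) (λ q → g (from q)) Q v → ModelVertex f g P v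
    pull q@(_ , gv) = P-of q , trans (cong g (sym (from∘to (P-of q)))) gv

models⇒≅ : ∀ {K W} {P : W → Set} {R} → Models K P R → K ≅ Flag W P R
models⇒≅ {K} {W} {P} {R} M = record
  { f = f
  ; g = g
  ; f-face = λ G fG → let (ps , rs) = face⇒ fG in
      Allₚ.gmap⁺ proj₁ ps , λ a b a∈ b∈ → image-pair a∈ b∈ (λ {c} {d} c∈ d∈ → rs c d c∈ d∈)
  ; g-face = λ H (ps , rs) → face⇐ (Allₚ.gmap⁺ (λ Pp → subst P (sym (f∘g Pp)) Pp , cong g (f∘g Pp)) ps
      , λ a b a∈ b∈ → preimage-pair a∈ b∈ (λ {c} {d} c∈ d∈ → rs c d c∈ d∈) ps)
  ; gf = λ v fv → proj₂ (All.head (proj₁ (face⇒ fv)))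
  ; fg = λ p (ps , _) → f∘g (All.head ps)
  }
  where
  open Models M
  image-pair : ∀ {G a b} → a ∈ map f G → b ∈ map f G → (∀ {c d} → c ∈ G → d ∈ G → R (f c) (f d)) → R a b
  image-pair a∈ b∈ rs with ∈-map⁻ f a∈ | ∈-map⁻ f b∈
  ... | c , c∈ , refl | d , d∈ , refl = rs c∈ d∈
  preimage-pair : ∀ {H a b} → a ∈ map g H → b ∈ map g H → (∀ {c d} → c ∈ H → d ∈ H → R c d) → All P H →
                  R (f a) (f b)
  preimage-pair a∈ b∈ rs ps with ∈-map⁻ g a∈ | ∈-map⁻ g b∈
  ... | c , c∈ , refl | d , d∈ , refl =
    subst₂ R (sym (f∘g (All.lookup ps c∈))) (sym (f∘g (All.lookup ps d∈))) (rs c∈ d∈)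

flagFace-++-edge : ∀ {V} {Q : V → Set} {S : Rel V 0ℓ} {G c d} → Symmetric S →
                   FlagFace Q S G → Q c → Q d → S c c → S d d → S c d →
                   (∀ {a} → a ∈ G → S a c × S a d) → FlagFace Q S (G ++ c ∷ d ∷ [])
flagFace-++-edge {V} {Q} {S} {G} {c} {d} S-sym (qs , ss) Qc Qd Scc Sdd Scd S-cone =
  Allₚ.++⁺ qs (Qc ∷ Qd ∷ All.[]) , λ a b a∈ b∈ → pair (split a∈) (split b∈)
  where
  Where : V → Set
  Where a = a ∈ G ⊎ a ≡ c ⊎ a ≡ d
  split : ∀ {a} → a ∈ G ++ c ∷ d ∷ [] → Where a
  split a∈ with ∈-++⁻ G a∈
  ... | inj₁ a∈G = inj₁ a∈G
  ... | inj₂ (here refl) = inj₂ (inj₁ refl)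
  ... | inj₂ (there (here refl)) = inj₂ (inj₂ refl)
  pair : ∀ {a b} → Where a → Where b → S a b
  pair (inj₁ a∈) (inj₁ b∈) = ss _ _ a∈ b∈
  pair (inj₁ a∈) (inj₂ (inj₁ refl)) = proj₁ (S-cone a∈)
  pair (inj₁ a∈) (inj₂ (inj₂ refl)) = proj₂ (S-cone a∈)
  pair (inj₂ (inj₁ refl)) (inj₁ b∈) = S-sym (proj₁ (S-cone b∈))
  pair (inj₂ (inj₂ refl)) (inj₁ b∈) = S-sym (proj₂ (S-cone b∈))
  pair (inj₂ (inj₁ refl)) (inj₂ (inj₁ refl)) = Scc
  pair (inj₂ (inj₁ refl)) (inj₂ (inj₂ refl)) = Scd
  pair (inj₂ (inj₂ refl)) (inj₂ (inj₁ refl)) = S-sym Scd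
  pair (inj₂ (inj₂ refl)) (inj₂ (inj₂ refl)) = Sdd

-- (P', R') describes the stellar subdivision of the flag complex of (P, R)
-- at its edge {u, w}, with m as the new vertex.
record EdgeSubdivision {W : Set} (P : W → Set) (R : Rel W 0ℓ) (u w m : W)
                       (P' : W → Set) (R' : Rel W 0ℓ) : Set where
  field
    R-refl : Reflexive R
    R-sym : Symmetric R
    R'-refl : Reflexive R'
    R'-sym : Symmetric R'
    P-u : P u
    P-w : P w
    R-uw : R u w
    ¬P-m : ¬ P m
    P'-m : P' m
    P⇒P' : ∀ {p} → P p → P' p
    P'⇒P : ∀ {p} → P' p → p ≢ m → P p
    ¬R'-uw : ¬ R' u w
    R⇒R' : ∀ {a b} → P a → P b → R a b → ¬ (a ≡ u × b ≡ w) → ¬ (a ≡ w × b ≡ u) → R' a b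
    R'⇒R : ∀ {a b} → P a → P b → R' a b → R a b
    cone⇒R' : ∀ {a} → P a → R a u → R a w → R' a m
    R'⇒cone : ∀ {a} → P a → R' a m → R a u × R a w

lefts⁺ : ∀ {A B : Set} {v : A} {H : List (A ⊎ B)} → inj₁ v ∈ H → v ∈ lefts H
lefts⁺ {H = inj₁ _ ∷ _} (here refl) = here refl
lefts⁺ {H = inj₁ _ ∷ _} (there v∈) = there (lefts⁺ v∈)
lefts⁺ {H = inj₂ _ ∷ _} (there v∈) = lefts⁺ v∈

lefts⁻ : ∀ {A B : Set} {v : A} (H : List (A ⊎ B)) → v ∈ lefts H → inj₁ v ∈ H
lefts⁻ (inj₁ _ ∷ _) (here refl) = here refl
lefts⁻ (inj₁ _ ∷ H) (there v∈) = there (lefts⁻ H v∈)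
lefts⁻ (inj₂ _ ∷ H) v∈ = there (lefts⁻ H v∈)

module StellarModel {K : Complex} {W : Set} (_≟_ : DecidableEquality W)
                    {P : W → Set} {R : Rel W 0ℓ} (M : Models K P R)
                    {u w m : W} {P' : W → Set} {R' : Rel W 0ℓ}
                    (E : EdgeSubdivision P R u w m P' R') where
  open Models M
  open EdgeSubdivision E

  f' : Vert K ⊎ ⊤ → W
  f' (inj₁ v) = f v
  f' (inj₂ _) = m

  g' : W → Vert K ⊎ ⊤
  g' q with q ≟ m
  ... | yes _ = inj₂ tt
  ... | no _ = inj₁ (g q)

  g'-m : g' m ≡ inj₂ tt
  g'-m with m ≟ m
  ... | yes _ = refl
  ... | no m≢m = ⊥-elim (m≢m refl)

  g'-old : ∀ {q} → q ≢ m → g' q ≡ inj₁ (g q)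
  g'-old {q} q≢m with q ≟ m
  ... | yes q≡m = ⊥-elim (q≢m q≡m)
  ... | no _ = refl

  g'≡inj₁ : ∀ {q v} → g' q ≡ inj₁ v → q ≢ m × g q ≡ v
  g'≡inj₁ {q} eq with q ≟ m
  g'≡inj₁ () | yes _
  g'≡inj₁ refl | no q≢m = q≢m , refl

  edge : List (Vert K)
  edge = g u ∷ g w ∷ []

  P-≢m : ∀ {p} → P p → p ≢ m
  P-≢m Pp refl = ¬P-m Pp

  vertex-g : ∀ {p} → P p → ModelVertex f g P (g p)
  vertex-g Pp = subst P (sym (f∘g Pp)) Pp , cong g (f∘g Pp)

  forward : ∀ H → Face (sd K edge) H → PullbackFace f' g' P' R' H
  forward H (fG , edge⊈G , fGe) = All.tabulate vertex' , λ a b a∈ b∈ → pair a b a∈ b∈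
    where
    G = lefts H
    old = face⇒ fG
    old-vertex : ∀ {v} → inj₁ v ∈ H → ModelVertex f g P v
    old-vertex v∈ = All.lookup (proj₁ old) (lefts⁺ v∈)
    vertex' : ∀ {h} → h ∈ H → ModelVertex f' g' P' h
    vertex' {inj₁ v} v∈ = let (Pv , gfv) = old-vertex v∈ in
      P⇒P' Pv , trans (g'-old (P-≢m Pv)) (cong inj₁ gfv)
    vertex' {inj₂ tt} _ = P'-m , g'-m
    not-edge : ∀ {a b} → inj₁ a ∈ H → inj₁ b ∈ H → ¬ (f a ≡ u × f b ≡ w)
    not-edge {a} {b} a∈ b∈ (refl , refl) = edge⊈G λ
      { (here refl) → subst (_∈ G) (sym (proj₂ (old-vertex a∈))) (lefts⁺ a∈)
      ; (there (here refl)) → subst (_∈ G) (sym (proj₂ (old-vertex b∈))) (lefts⁺ b∈) }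
    cone : ∀ {a} → inj₂ tt ∈ H → inj₁ a ∈ H → R' (f a) m
    cone {a} t∈ a∈ = cone⇒R' (proj₁ (old-vertex a∈))
      (subst (R (f a)) (f∘g P-u) (rs _ _ (∈-++⁺ˡ (lefts⁺ a∈)) (∈-++⁺ʳ G (here refl))))
      (subst (R (f a)) (f∘g P-w) (rs _ _ (∈-++⁺ˡ (lefts⁺ a∈)) (∈-++⁺ʳ G (there (here refl)))))
      where rs = proj₂ (face⇒ (fGe t∈))
    pair : ∀ a b → a ∈ H → b ∈ H → R' (f' a) (f' b)
    pair (inj₁ a) (inj₁ b) a∈ b∈ = R⇒R' (proj₁ (old-vertex a∈)) (proj₁ (old-vertex b∈))
      (proj₂ old _ _ (lefts⁺ a∈) (lefts⁺ b∈))
      (not-edge a∈ b∈) (λ (fa≡w , fb≡u) → not-edge b∈ a∈ (fb≡u , fa≡w))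
    pair (inj₁ a) (inj₂ tt) a∈ t∈ = cone t∈ a∈
    pair (inj₂ tt) (inj₁ b) t∈ b∈ = R'-sym (cone t∈ b∈)
    pair (inj₂ tt) (inj₂ tt) _ _ = R'-refl

  backward : ∀ H → PullbackFace f' g' P' R' H → Face (sd K edge) H
  backward H (vs , rs) = face⇐ (All.tabulate old-vertex , λ a b a∈ b∈ → old-pair a∈ b∈) , edge⊈G , fGe
    where
    G = lefts H
    old-vertex : ∀ {v} → v ∈ G → ModelVertex f g P v
    old-vertex v∈ with All.lookup vs (lefts⁻ H v∈)
    ... | P'v , g'fv = let (fv≢m , gfv) = g'≡inj₁ g'fv in P'⇒P P'v fv≢m , gfv
    old-pair : ∀ {a b} → a ∈ G → b ∈ G → R (f a) (f b)
    old-pair a∈ b∈ = R'⇒R (proj₁ (old-vertex a∈)) (proj₁ (old-vertex b∈)) (rs _ _ (lefts⁻ H a∈) (lefts⁻ H b∈))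
    edge⊈G : ¬ (edge ⊆ G)
    edge⊈G e⊆G = ¬R'-uw (subst₂ R' (f∘g P-u) (f∘g P-w)
      (rs _ _ (lefts⁻ H (e⊆G (here refl))) (lefts⁻ H (e⊆G (there (here refl))))))
    fGe : inj₂ tt ∈ H → Face K (G ++ edge)
    fGe t∈ = face⇐ (flagFace-++-edge R-sym (All.tabulate old-vertex , λ a b a∈ b∈ → old-pair a∈ b∈)
      (vertex-g P-u) (vertex-g P-w) R-refl R-refl (subst₂ R (sym (f∘g P-u)) (sym (f∘g P-w)) R-uw) cone)
      where
      cone : ∀ {a} → a ∈ G → R (f a) (f (g u)) × R (f a) (f (g w))
      cone a∈ with R'⇒cone (proj₁ (old-vertex a∈)) (rs _ _ (lefts⁻ H a∈) t∈)
      ... | Rau , Raw = subst (R _) (sym (f∘g P-u)) Rau , subst (R _) (sym (f∘g P-w)) Raw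

  models : Models (sd K edge) P' R'
  models = record
    { f = f'
    ; g = g'
    ; faces = λ H → mk⇔ (forward H) (backward H)
    ; f∘g = section
    }
    where
    section : ∀ {q} → P' q → f' (g' q) ≡ q
    section {q} P'q with q ≟ m
    ... | yes refl = refl
    ... | no q≢m = f∘g (P'⇒P P'q q≢m)

-- Lengths of intervals

bounded-max : {P : ℕ → Set} → (∀ k → Dec (P k)) → ∀ m → (∀ {j} → P j → j ≤ℕ m) → ∃ P →
              ∃ λ k → P k × (∀ {j} → P j → j ≤ℕ k)
bounded-max P? m bound (j , Pj) with P? m
... | yes Pm = m , Pm , bound
bounded-max P? zero bound (j , Pj) | no ¬P0 with bound Pj
... | z≤n = ⊥-elim (¬P0 Pj)
bounded-max {P} P? (suc m) bound ∃P | no ¬Pm = bounded-max P? m bound' ∃P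
  where
  bound' : ∀ {j} → P j → j ≤ℕ m
  bound' Pj = ℕₚ.≤-pred (ℕₚ.≤∧≢⇒< (bound Pj) λ { refl → ¬Pm Pj })

module IntervalLengths {n : ℕ} (L : FinLattice n) where
  open FinLattice L
  open IsBoundedLattice isBoundedLattice using (antisym; x≤x∨y; y≤x∨y; ∨-least)
    renaming (refl to ≤-refl; trans to ≤-trans)

  _≤?_ : ∀ x y → Dec (x ≤ y)
  x ≤? y with (x ∨ y) ≟ᶠ y
  ... | yes x∨y≡y = yes (subst (x ≤_) x∨y≡y (x≤x∨y x y))
  ... | no x∨y≢y = no λ x≤y → x∨y≢y (antisym (∨-least x≤y ≤-refl) (y≤x∨y x y))

  _<?_ : ∀ x y → Dec (x < y)
  x <? y with x ≤? y | x ≟ᶠ y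
  ... | yes x≤y | no x≢y = yes (x≤y , x≢y)
  ... | no x≰y | _ = no λ x<y → x≰y (proj₁ x<y)
  ... | _ | yes x≡y = no λ x<y → proj₂ x<y x≡y

  upset : Fin n → Subset n
  upset c = tabulate λ z → does (c ≤? z)

  ∈-upset⁺ : ∀ {c z} → c ≤ z → z ∈ₛ upset c
  ∈-upset⁺ {c} {z} c≤z = lookup⇒[]= z _ (trans (lookup∘tabulate _ z) (dec-true (c ≤? z) c≤z))

  ∈-upset⁻ : ∀ {c z} → z ∈ₛ upset c → c ≤ z
  ∈-upset⁻ {c} {z} z∈ = witness (c ≤? z) (trans (sym (lookup∘tabulate _ z)) ([]=⇒lookup z∈))
    where
    witness : (c≤?z : Dec (c ≤ z)) → does c≤?z ≡ true → c ≤ z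
    witness (yes c≤z) _ = c≤z

  upset-⊂ : ∀ {x y} → x < y → upset y ⊂ₛ upset x
  upset-⊂ {x} {y} (x≤y , x≢y) =
    (λ z∈ → ∈-upset⁺ (≤-trans x≤y (∈-upset⁻ z∈))) ,
    x , ∈-upset⁺ ≤-refl , λ x∈ → x≢y (antisym x≤y (∈-upset⁻ x∈))

  -- strict chains shrink up-sets, which bounds their length by n
  chain-upsets : ∀ {x y k} → Chain x y k → k + ∣ upset y ∣ ≤ℕ ∣ upset x ∣
  chain-upsets done = ℕₚ.≤-refl
  chain-upsets (step x<z c) = ℕₚ.≤-trans (s≤s (chain-upsets c)) (p⊂q⇒∣p∣<∣q∣ (upset-⊂ x<z))

  chain-length≤n : ∀ {x y k} → Chain x y k → k ≤ℕ n
  chain-length≤n {x} {k = k} c = ℕₚ.≤-trans (ℕₚ.m≤m+n k _) (ℕₚ.≤-trans (chain-upsets c) (∣p∣≤n (upset x)))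

  chain? : ∀ k x z → Dec (Chain x z k)
  chain? zero x z with x ≟ᶠ z
  ... | yes refl = yes done
  ... | no x≢z = no λ { done → x≢z refl }
  chain? (suc k) x z with any? (λ y → (x <? y) ×-dec chain? k y z)
  ... | yes (y , x<y , c) = yes (step x<y c)
  ... | no ¬c = no λ { (step x<y c) → ¬c (_ , x<y , c) }

  chain-snoc : ∀ {x y z k} → Chain x y k → y < z → Chain x z (suc k)
  chain-snoc done y<z = step y<z done
  chain-snoc (step x<w c) y<z = step x<w (chain-snoc c y<z)

  HasLength : Fin n × Fin n → Set
  HasLength (x , y) = ∃ (IntervalLength x y)

  intervalLength : ∀ {x y} → x ≤ y → HasLength (x , y)
  intervalLength {x} {y} x≤y with bounded-max (λ k → chain? k x y) n chain-length≤n (some-chain (x ≟ᶠ y))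
    where
    some-chain : Dec (x ≡ y) → ∃ (Chain x y)
    some-chain (yes refl) = 0 , done
    some-chain (no x≢y) = 1 , step (x≤y , x≢y) done
  ... | k , c , max = k , c , λ j c' → max c'

  intervalLength-strict : ∀ {v x y w k k'} → v ≤ x → y ≤ w → (v , w) ≢ (x , y) →
                          IntervalLength x y k → IntervalLength v w k' → k <ℕ k'
  intervalLength-strict {v} {x} {y} {w} v≤x y≤w vw≢xy (c , _) (_ , max) with v ≟ᶠ x | y ≟ᶠ w
  ... | yes refl | yes refl = ⊥-elim (vw≢xy refl)
  ... | no v≢x | yes refl = max _ (step (v≤x , v≢x) c)
  ... | yes refl | no y≢w = max _ (chain-snoc c (y≤w , y≢w))
  ... | no v≢x | no y≢w = ℕₚ.≤-trans (ℕₚ.n≤1+n _) (max _ (step (v≤x , v≢x) (chain-snoc c (y≤w , y≢w))))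

  LengthLE-trans : ∀ {p q r} → HasLength q → LengthLE p q → LengthLE q r → LengthLE p r
  LengthLE-trans (j , lq) p≤q q≤r k k' lp lr = ℕₚ.≤-trans (p≤q k j lp lq) (q≤r j k' lq lr)

  longer⇒¬LengthLE : ∀ {v x y w} → v ≤ x → x ≤ y → y ≤ w → (v , w) ≢ (x , y) → ¬ LengthLE (v , w) (x , y)
  longer⇒¬LengthLE v≤x x≤y y≤w vw≢xy vw≤xy
    with intervalLength x≤y | intervalLength (≤-trans v≤x (≤-trans x≤y y≤w))
  ... | k , lxy | k' , lvw = ℕₚ.<⇒≱ (intervalLength-strict v≤x y≤w vw≢xy lxy lvw) (vw≤xy k' k lvw lxy)

  linked⇒all : ∀ {p q qs} → All HasLength (q ∷ qs) → LengthLE p q → Linked LengthLE (q ∷ qs) →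
               All (LengthLE p) (q ∷ qs)
  linked⇒all (_ ∷ []) p≤q [-] = p≤q ∷ []
  linked⇒all (hq ∷ hqs) p≤q (q≤r ∷ l) = p≤q ∷ linked⇒all hqs (LengthLE-trans hq p≤q q≤r) l

  linked⇒allPairs : ∀ {qs} → All HasLength qs → Linked LengthLE qs → AllPairs LengthLE qs
  linked⇒allPairs [] [] = []
  linked⇒allPairs (_ ∷ []) [-] = [] ∷ []
  linked⇒allPairs (_ ∷ hqs) (q≤r ∷ l) = linked⇒all hqs q≤r l ∷ linked⇒allPairs hqs l

-- Intervals as vertices of the partially subdivided complex

module BierModel {n : ℕ} (L : FinLattice n) (I : Subset n) (I-ideal : FinLattice.IsProperIdeal L I) where
  open FinLattice L
  open IsBoundedLattice isBoundedLattice using (antisym; maximum; minimum)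
    renaming (refl to ≤-refl; trans to ≤-trans)

  Interval : Set
  Interval = Fin n × Fin n

  _≟_ : DecidableEquality Interval
  _≟_ = ≡-dec _≟ᶠ_ _≟ᶠ_

  ≤bot⇒≡ : ∀ {x} → x ≤ bot → x ≡ bot
  ≤bot⇒≡ x≤bot = antisym x≤bot (minimum _)

  top≤⇒≡ : ∀ {x} → top ≤ x → x ≡ top
  top≤⇒≡ top≤x = antisym (maximum _) top≤x

  down-closed : ∀ {x y} → x ≤ y → y ∈ₛ I → x ∈ₛ I
  down-closed x≤y = proj₁ I-ideal _ _ x≤y

  bot∈I : bot ∈ₛ I
  bot∈I = let (x , x∈I) = proj₁ (proj₂ I-ideal) in down-closed (minimum x) x∈I

  top∉I : top ∉ₛ I
  top∉I top∈I = let (y , y∉I) = proj₂ (proj₂ I-ideal) in y∉I (down-closed (maximum y) top∈I)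

  ∉I⇒≢bot : ∀ {y} → y ∉ₛ I → y ≢ bot
  ∉I⇒≢bot y∉I refl = y∉I bot∈I

  inS : ∀ {a b} → a ∈ₛ I → b ∉ₛ I → a ≤ b → a ≢ bot → b ≢ top → InS I (a , b)
  inS a∈I b∉I a≤b a≢bot b≢top =
    (a∈I , a≢bot) , ((∉I⇒≢bot b∉I , b≢top) , b∉I) , a≤b , λ { refl → b∉I a∈I }

  InS⇒≤ : ∀ {a b} → InS I (a , b) → a ≤ b
  InS⇒≤ (_ , _ , a<b) = proj₁ a<b

  Proper : Fin n → Set
  Proper a = a ≢ bot × a ≢ top

  BierVertex : Interval → Set
  BierVertex (x , y) = x ∈ₛ I × y ∉ₛ I × x ≤ y × ¬ (x ≡ bot × y ≡ top)

  Contains : Interval → Interval → Set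
  Contains (x , y) (v , w) = x ≤ v × w ≤ y

  Comparable : Interval → Interval → Set
  Comparable p q = Contains p q ⊎ Contains q p

  -- Done is the set of edges of S subdivided so far; (x , 1̂) stands for x ∈ I,
  -- (0̂ , y) for y ∉ I, and (x , y) for the new vertex of the edge {x, y}.
  Vertex : Pred Interval 0ℓ → Interval → Set
  Vertex Done (x , y) = BierVertex (x , y) × (x ≡ bot ⊎ y ≡ top ⊎ Done (x , y))

  Pending : Pred Interval 0ℓ → Interval → Interval → Set
  Pending Done (x , y) (v , w) = y ≡ top × v ≡ bot × x ≤ w × ¬ Done (x , w)

  Compatible : Pred Interval 0ℓ → Interval → Interval → Set
  Compatible Done p q = Comparable p q ⊎ Pending Done p q ⊎ Pending Done q p

  Compatible-refl : ∀ {Done p} → Compatible Done p p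
  Compatible-refl = inj₁ (inj₁ (≤-refl , ≤-refl))

  Compatible-sym : ∀ {Done p q} → Compatible Done p q → Compatible Done q p
  Compatible-sym (inj₁ (inj₁ c)) = inj₁ (inj₂ c)
  Compatible-sym (inj₁ (inj₂ c)) = inj₁ (inj₁ c)
  Compatible-sym (inj₂ (inj₁ pend)) = inj₂ (inj₂ pend)
  Compatible-sym (inj₂ (inj₂ pend)) = inj₂ (inj₁ pend)

  asInterval : Fin n → Interval
  asInterval a with a ∈ₛ? I
  ... | yes _ = a , top
  ... | no _ = bot , a

  data AsInterval (a : Fin n) : Interval → Set where
    upper : a ∈ₛ I → AsInterval a (a , top)
    lower : a ∉ₛ I → AsInterval a (bot , a)

  asInterval-view : ∀ a → AsInterval a (asInterval a)
  asInterval-view a with a ∈ₛ? I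
  ... | yes a∈I = upper a∈I
  ... | no a∉I = lower a∉I

  asInterval-upper : ∀ {a} → a ∈ₛ I → asInterval a ≡ (a , top)
  asInterval-upper {a} a∈I with asInterval a | asInterval-view a
  ... | _ | upper _ = refl
  ... | _ | lower a∉I = ⊥-elim (a∉I a∈I)

  asInterval-lower : ∀ {a} → a ∉ₛ I → asInterval a ≡ (bot , a)
  asInterval-lower {a} a∉I with asInterval a | asInterval-view a
  ... | _ | upper a∈I = ⊥-elim (a∉I a∈I)
  ... | _ | lower _ = refl

  fromInterval : Interval → Fin n
  fromInterval (v , w) with v ≟ᶠ bot
  ... | yes _ = w
  ... | no _ = v

  fromInterval-lower : ∀ w → fromInterval (bot , w) ≡ w
  fromInterval-lower w with bot ≟ᶠ bot
  ... | yes _ = refl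
  ... | no bot≢bot = ⊥-elim (bot≢bot refl)

  fromInterval-upper : ∀ {v} w → v ≢ bot → fromInterval (v , w) ≡ v
  fromInterval-upper {v} w v≢bot with v ≟ᶠ bot
  ... | yes v≡bot = ⊥-elim (v≢bot v≡bot)
  ... | no _ = refl

  upper-upper : ∀ {Done a b} → Proper a → Proper b → Compatible Done (a , top) (b , top) → a ≤ b ⊎ b ≤ a
  upper-upper _ _ (inj₁ (inj₁ (a≤b , _))) = inj₁ a≤b
  upper-upper _ _ (inj₁ (inj₂ (b≤a , _))) = inj₂ b≤a
  upper-upper _ (b≢bot , _) (inj₂ (inj₁ (_ , b≡bot , _))) = ⊥-elim (b≢bot b≡bot)
  upper-upper (a≢bot , _) _ (inj₂ (inj₂ (_ , a≡bot , _))) = ⊥-elim (a≢bot a≡bot)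

  lower-lower : ∀ {Done a b} → Proper a → Proper b → Compatible Done (bot , a) (bot , b) → a ≤ b ⊎ b ≤ a
  lower-lower _ _ (inj₁ (inj₁ (_ , b≤a))) = inj₂ b≤a
  lower-lower _ _ (inj₁ (inj₂ (_ , a≤b))) = inj₁ a≤b
  lower-lower (_ , a≢top) _ (inj₂ (inj₁ (a≡top , _))) = ⊥-elim (a≢top a≡top)
  lower-lower _ (_ , b≢top) (inj₂ (inj₂ (b≡top , _))) = ⊥-elim (b≢top b≡top)

  upper-lower : ∀ {Done a b} → Proper a → Proper b → Compatible Done (a , top) (bot , b) → a ≤ b
  upper-lower (a≢bot , _) _ (inj₁ (inj₁ (a≤bot , _))) = ⊥-elim (a≢bot (≤bot⇒≡ a≤bot))
  upper-lower _ (_ , b≢top) (inj₁ (inj₂ (_ , top≤b))) = ⊥-elim (b≢top (top≤⇒≡ top≤b))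
  upper-lower _ _ (inj₂ (inj₁ (_ , _ , a≤b , _))) = a≤b
  upper-lower _ (_ , b≢top) (inj₂ (inj₂ (b≡top , _))) = ⊥-elim (b≢top b≡top)

  initial : FlagIso Proper (λ a b → a ≤ b ⊎ b ≤ a) (Vertex ∅) (Compatible ∅)
  initial = record
    { to = asInterval
    ; from = fromInterval
    ; to-vertex = to-vertex
    ; from∘to = from∘to
    ; to∘from = to∘from
    ; to-edge = to-edge
    }
    where
    to-vertex : ∀ {a} → Proper a ⇔ Vertex ∅ (asInterval a)
    to-vertex {a} with asInterval a | asInterval-view a
    ... | _ | upper a∈I = mk⇔
      (λ (a≢bot , _) → (a∈I , top∉I , maximum a , λ (a≡bot , _) → a≢bot a≡bot) , inj₂ (inj₁ refl))
      (λ ((_ , _ , _ , ¬corner) , _) → (λ a≡bot → ¬corner (a≡bot , refl)) , λ { refl → top∉I a∈I })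
    ... | _ | lower a∉I = mk⇔
      (λ (_ , a≢top) → (bot∈I , a∉I , minimum a , λ (_ , a≡top) → a≢top a≡top) , inj₁ refl)
      (λ ((_ , _ , _ , ¬corner) , _) → ∉I⇒≢bot a∉I , λ a≡top → ¬corner (refl , a≡top))

    from∘to : ∀ {a} → Proper a → fromInterval (asInterval a) ≡ a
    from∘to {a} (a≢bot , _) with asInterval a | asInterval-view a
    ... | _ | upper _ = fromInterval-upper top a≢bot
    ... | _ | lower _ = fromInterval-lower a

    to∘from : ∀ {q} → Vertex ∅ q → asInterval (fromInterval q) ≡ q
    to∘from {_ , w} ((_ , w∉I , _ , _) , inj₁ refl) = trans (cong asInterval (fromInterval-lower w)) (asInterval-lower w∉I)
    to∘from {v , _} ((v∈I , _ , _ , ¬corner) , inj₂ (inj₁ refl)) =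
      trans (cong asInterval (fromInterval-upper top λ v≡bot → ¬corner (v≡bot , refl))) (asInterval-upper v∈I)

    to-edge : ∀ {a b} → Proper a → Proper b → (a ≤ b ⊎ b ≤ a) ⇔ Compatible ∅ (asInterval a) (asInterval b)
    to-edge {a} {b} Pa Pb with asInterval a | asInterval-view a | asInterval b | asInterval-view b
    ... | _ | upper _ | _ | upper _ = mk⇔
      (λ { (inj₁ a≤b) → inj₁ (inj₁ (a≤b , ≤-refl)) ; (inj₂ b≤a) → inj₁ (inj₂ (b≤a , ≤-refl)) })
      (upper-upper Pa Pb)
    ... | _ | lower _ | _ | lower _ = mk⇔
      (λ { (inj₁ a≤b) → inj₁ (inj₂ (≤-refl , a≤b)) ; (inj₂ b≤a) → inj₁ (inj₁ (≤-refl , b≤a)) })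
      (lower-lower Pa Pb)
    ... | _ | upper a∈I | _ | lower b∉I = mk⇔
      (λ { (inj₁ a≤b) → inj₂ (inj₁ (refl , refl , a≤b , λ ()))
         ; (inj₂ b≤a) → ⊥-elim (b∉I (down-closed b≤a a∈I)) })
      (λ c → inj₁ (upper-lower Pa Pb c))
    ... | _ | lower a∉I | _ | upper b∈I = mk⇔
      (λ { (inj₁ a≤b) → ⊥-elim (a∉I (down-closed a≤b b∈I))
         ; (inj₂ b≤a) → inj₂ (inj₂ (refl , refl , b≤a , λ ())) })
      (λ c → inj₂ (upper-lower Pb Pa (Compatible-sym c)))

  module SubdivideEdge (Done : Pred Interval 0ℓ) {x y : Fin n} (xy∈S : InS I (x , y))
                       (done-not-above : ∀ {v w} → Done (v , w) → v ≤ x → y ≤ w → ⊥)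
                       (inside-done : ∀ {a b} → InS I (a , b) → x ≤ a → b ≤ y → (a , b) ≢ (x , y) → Done (a , b))
                       where
    Done' : Pred Interval 0ℓ
    Done' = Done ∪ ｛ x , y ｝

    x∈I : x ∈ₛ I
    x∈I = proj₁ (proj₁ xy∈S)

    x≢bot : x ≢ bot
    x≢bot = proj₂ (proj₁ xy∈S)

    y≢top : y ≢ top
    y≢top = proj₂ (proj₁ (proj₁ (proj₂ xy∈S)))

    y∉I : y ∉ₛ I
    y∉I = proj₂ (proj₁ (proj₂ xy∈S))

    x≤y : x ≤ y
    x≤y = InS⇒≤ xy∈S

    x-proper : Proper x
    x-proper = x≢bot , λ { refl → top∉I x∈I }

    y-proper : Proper y
    y-proper = ∉I⇒≢bot y∉I , y≢top

    undone-inside : ∀ {a b} → a ∈ₛ I → b ∉ₛ I → a ≤ b → x ≤ a → b ≤ y → ¬ Done (a , b) →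
                    (a , b) ≡ (x , y)
    undone-inside {a} {b} a∈I b∉I a≤b x≤a b≤y ¬done with (a , b) ≟ (x , y)
    ... | yes ab≡xy = ab≡xy
    ... | no ab≢xy = ⊥-elim (¬done (inside-done (inS a∈I b∉I a≤b a≢bot b≢top) x≤a b≤y ab≢xy))
      where
      a≢bot : a ≢ bot
      a≢bot refl = x≢bot (≤bot⇒≡ x≤a)
      b≢top : b ≢ top
      b≢top refl = y≢top (top≤⇒≡ b≤y)

    asInterval≢xy : ∀ a → asInterval a ≢ (x , y)
    asInterval≢xy a eq with asInterval a | asInterval-view a
    asInterval≢xy a refl | _ | upper _ = y≢top refl
    asInterval≢xy a refl | _ | lower _ = x≢bot refl

    towards-u : ∀ {v w} → Compatible Done (v , w) (x , top) →
                (v ≤ x × w ≡ top) ⊎ x ≤ v ⊎ (v ≡ bot × x ≤ w × ¬ Done (x , w))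
    towards-u (inj₁ (inj₁ (v≤x , top≤w))) = inj₁ (v≤x , top≤⇒≡ top≤w)
    towards-u (inj₁ (inj₂ (x≤v , _))) = inj₂ (inj₁ x≤v)
    towards-u (inj₂ (inj₁ (_ , x≡bot , _))) = ⊥-elim (x≢bot x≡bot)
    towards-u (inj₂ (inj₂ (_ , v≡bot , x≤w , ¬done))) = inj₂ (inj₂ (v≡bot , x≤w , ¬done))

    towards-w : ∀ {v w} → Compatible Done (v , w) (bot , y) →
                (v ≡ bot × y ≤ w) ⊎ w ≤ y ⊎ (w ≡ top × v ≤ y × ¬ Done (v , y))
    towards-w (inj₁ (inj₁ (v≤bot , y≤w))) = inj₁ (≤bot⇒≡ v≤bot , y≤w)
    towards-w (inj₁ (inj₂ (_ , w≤y))) = inj₂ (inj₁ w≤y)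
    towards-w (inj₂ (inj₁ (w≡top , _ , v≤y , ¬done))) = inj₂ (inj₂ (w≡top , v≤y , ¬done))
    towards-w (inj₂ (inj₂ (y≡top , _))) = ⊥-elim (y≢top y≡top)

    -- The non-comparable cases would give an undone edge of S strictly inside [x, y].
    cone⇒compatible : ∀ {v w} → Vertex Done (v , w) → Compatible Done (v , w) (x , top) →
                      Compatible Done (v , w) (bot , y) → Compatible Done' (v , w) (x , y)
    cone⇒compatible {v} {w} ((v∈I , w∉I , v≤w , ¬corner) , _) cu cw = inj₁ (cases (towards-u cu) (towards-w cw))
      where
      cases : _ → _ → Comparable (v , w) (x , y)
      cases (inj₁ (v≤x , refl)) _ = inj₁ (v≤x , maximum y)
      cases (inj₂ (inj₁ x≤v)) (inj₁ (refl , _)) = ⊥-elim (x≢bot (≤bot⇒≡ x≤v))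
      cases (inj₂ (inj₁ x≤v)) (inj₂ (inj₁ w≤y)) = inj₂ (x≤v , w≤y)
      cases (inj₂ (inj₁ x≤v)) (inj₂ (inj₂ (refl , v≤y , ¬done)))
        with undone-inside v∈I y∉I v≤y x≤v ≤-refl ¬done
      ... | refl = inj₁ (≤-refl , maximum y)
      cases (inj₂ (inj₂ (refl , x≤w , ¬done))) (inj₁ (_ , y≤w)) = inj₁ (minimum x , y≤w)
      cases (inj₂ (inj₂ (refl , x≤w , ¬done))) (inj₂ (inj₁ w≤y))
        with undone-inside x∈I w∉I x≤w ≤-refl w≤y ¬done
      ... | refl = inj₁ (minimum x , ≤-refl)
      cases (inj₂ (inj₂ (refl , _))) (inj₂ (inj₂ (refl , _))) = ⊥-elim (¬corner (refl , refl))

    compatible⇒cone : ∀ {v w} → Vertex Done (v , w) → Compatible Done' (v , w) (x , y) →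
                      Compatible Done (v , w) (x , top) × Compatible Done (v , w) (bot , y)
    compatible⇒cone _ (inj₁ (inj₂ (x≤v , w≤y))) = inj₁ (inj₂ (x≤v , maximum _)) , inj₁ (inj₂ (minimum _ , w≤y))
    compatible⇒cone _ (inj₂ (inj₁ (_ , x≡bot , _))) = ⊥-elim (x≢bot x≡bot)
    compatible⇒cone _ (inj₂ (inj₂ (y≡top , _))) = ⊥-elim (y≢top y≡top)
    compatible⇒cone (_ , inj₁ refl) (inj₁ (inj₁ (_ , y≤w))) =
      inj₂ (inj₂ (refl , refl , ≤-trans x≤y y≤w , λ xw-done → done-not-above xw-done ≤-refl y≤w)) ,
      inj₁ (inj₁ (≤-refl , y≤w))
    compatible⇒cone (_ , inj₂ (inj₁ refl)) (inj₁ (inj₁ (v≤x , _))) =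
      inj₁ (inj₁ (v≤x , ≤-refl)) ,
      inj₂ (inj₁ (refl , refl , ≤-trans v≤x x≤y , λ vy-done → done-not-above vy-done v≤x ≤-refl))
    compatible⇒cone (_ , inj₂ (inj₂ is-done)) (inj₁ (inj₁ (v≤x , y≤w))) = ⊥-elim (done-not-above is-done v≤x y≤w)

    pending⇒pending' : ∀ {p q} → Pending Done p q → ¬ (p ≡ (x , top) × q ≡ (bot , y)) → Pending Done' p q
    pending⇒pending' {a , _} {_ , d} (refl , refl , a≤d , ¬done) ¬uw =
      refl , refl , a≤d , λ { (inj₁ is-done) → ¬done is-done ; (inj₂ refl) → ¬uw (refl , refl) }

    pending'⇒pending : ∀ {p q} → Pending Done' p q → Pending Done p q
    pending'⇒pending {_ , _} {_ , _} (b≡top , c≡bot , a≤d , ¬done') =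
      b≡top , c≡bot , a≤d , λ ad-done → ¬done' (inj₁ ad-done)

    subdivision : EdgeSubdivision (Vertex Done) (Compatible Done) (x , top) (bot , y) (x , y)
                                  (Vertex Done') (Compatible Done')
    subdivision = record
      { R-refl = Compatible-refl {Done}
      ; R-sym = Compatible-sym {Done}
      ; R'-refl = Compatible-refl {Done'}
      ; R'-sym = Compatible-sym {Done'}
      ; P-u = (x∈I , top∉I , maximum x , λ (x≡bot , _) → x≢bot x≡bot) , inj₂ (inj₁ refl)
      ; P-w = (bot∈I , y∉I , minimum y , λ (_ , y≡top) → y≢top y≡top) , inj₁ refl
      ; R-uw = inj₂ (inj₁ (refl , refl , x≤y , λ is-done → done-not-above is-done ≤-refl ≤-refl))
      ; ¬P-m = λ { (_ , inj₁ x≡bot) → x≢bot x≡bot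
                 ; (_ , inj₂ (inj₁ y≡top)) → y≢top y≡top
                 ; (_ , inj₂ (inj₂ is-done)) → done-not-above is-done ≤-refl ≤-refl }
      ; P'-m = (x∈I , y∉I , x≤y , λ (x≡bot , _) → x≢bot x≡bot) , inj₂ (inj₂ (inj₂ refl))
      ; P⇒P' = λ { {_ , _} (bv , inj₁ e) → bv , inj₁ e
                 ; {_ , _} (bv , inj₂ (inj₁ e)) → bv , inj₂ (inj₁ e)
                 ; {_ , _} (bv , inj₂ (inj₂ is-done)) → bv , inj₂ (inj₂ (inj₁ is-done)) }
      ; P'⇒P = λ { {_ , _} (bv , inj₁ e) _ → bv , inj₁ e
                 ; {_ , _} (bv , inj₂ (inj₁ e)) _ → bv , inj₂ (inj₁ e)
                 ; {_ , _} (bv , inj₂ (inj₂ (inj₁ is-done))) _ → bv , inj₂ (inj₂ is-done)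
                 ; {_ , _} (_ , inj₂ (inj₂ (inj₂ refl))) p≢xy → ⊥-elim (p≢xy refl) }
      ; ¬R'-uw = λ { (inj₁ (inj₁ (x≤bot , _))) → x≢bot (≤bot⇒≡ x≤bot)
                   ; (inj₁ (inj₂ (_ , top≤y))) → y≢top (top≤⇒≡ top≤y)
                   ; (inj₂ (inj₁ (_ , _ , _ , ¬done'))) → ¬done' (inj₂ refl)
                   ; (inj₂ (inj₂ (y≡top , _))) → y≢top y≡top }
      ; R⇒R' = λ { _ _ (inj₁ c) _ _ → inj₁ c
                 ; _ _ (inj₂ (inj₁ pend)) ¬uw _ → inj₂ (inj₁ (pending⇒pending' pend ¬uw))
                 ; _ _ (inj₂ (inj₂ pend)) _ ¬wu →
                     inj₂ (inj₂ (pending⇒pending' pend λ (e₁ , e₂) → ¬wu (e₂ , e₁))) }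
      ; R'⇒R = λ { _ _ (inj₁ c) → inj₁ c
                 ; _ _ (inj₂ (inj₁ pend)) → inj₂ (inj₁ (pending'⇒pending pend))
                 ; _ _ (inj₂ (inj₂ pend)) → inj₂ (inj₂ (pending'⇒pending pend)) }
      ; cone⇒R' = λ { {_ , _} → cone⇒compatible }
      ; R'⇒cone = λ { {_ , _} → compatible⇒cone }
      }

  final : ∀ {Done} → (∀ {q} → InS I q → Done q) → FlagIso (Vertex Done) (Compatible Done) BierVertex Comparable
  final {Done} S⊆Done = record
    { to = λ p → p
    ; from = λ p → p
    ; to-vertex = λ { {_ , _} → mk⇔ proj₁ vertex }
    ; from∘to = λ _ → refl
    ; to∘from = λ _ → refl
    ; to-edge = λ Pp Pq → mk⇔ (comparable Pp Pq) inj₁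
    }
    where
    vertex : ∀ {v w} → BierVertex (v , w) → Vertex Done (v , w)
    vertex {v} {w} bv@(v∈I , w∉I , v≤w , ¬corner) with v ≟ᶠ bot | w ≟ᶠ top
    ... | yes v≡bot | _ = bv , inj₁ v≡bot
    ... | no _ | yes w≡top = bv , inj₂ (inj₁ w≡top)
    ... | no v≢bot | no w≢top = bv , inj₂ (inj₂ (S⊆Done (inS v∈I w∉I v≤w v≢bot w≢top)))
    not-pending : ∀ {p q} → Vertex Done p → Vertex Done q → ¬ Pending Done p q
    not-pending {a , _} {_ , d} ((a∈I , _ , _ , ¬corner) , _) ((_ , d∉I , _ , ¬corner') , _) (refl , refl , a≤d , ¬done) =
      ¬done (S⊆Done (inS a∈I d∉I a≤d (λ a≡bot → ¬corner (a≡bot , refl)) (λ d≡top → ¬corner' (refl , d≡top))))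
    comparable : ∀ {p q} → Vertex Done p → Vertex Done q → Compatible Done p q → Comparable p q
    comparable _ _ (inj₁ c) = c
    comparable Pp Pq (inj₂ (inj₁ pend)) = ⊥-elim (not-pending Pp Pq pend)
    comparable Pp Pq (inj₂ (inj₂ pend)) = ⊥-elim (not-pending Pq Pp pend)

-- Subdividing the edges of S in order of length

module Induction {n : ℕ} (L : FinLattice n) (I : Subset n) (I-ideal : FinLattice.IsProperIdeal L I) where
  open FinLattice L
  open IntervalLengths L
  open BierModel L I I-ideal

  record Schedule (Done : Pred Interval 0ℓ) (rest : List Interval) : Set where
    field
      covers : ∀ {q} → InS I q → Done q ⊎ q ∈ rest
      done∉rest : ∀ {q} → Done q → q ∉ rest
      done-first : ∀ {q r} → Done q → r ∈ rest → LengthLE q r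
      rest⊆S : All (InS I) rest
      rest-unique : Unique rest
      rest-sorted : AllPairs LengthLE rest

  schedule-start : ∀ {es} → (∀ e → (e ∈ es) ⇔ InS I e) → Unique es → Linked LengthLE es → Schedule ∅ es
  schedule-start {es} es≡S es-unique es-linked = record
    { covers = λ {q} q∈S → inj₂ (Equivalence.from (es≡S q) q∈S)
    ; done∉rest = λ ()
    ; done-first = λ ()
    ; rest⊆S = es⊆S
    ; rest-unique = es-unique
    ; rest-sorted = linked⇒allPairs (All.map (λ { {_ , _} e∈S → intervalLength (InS⇒≤ e∈S) }) es⊆S) es-linked
    }
    where
    es⊆S : All (InS I) es
    es⊆S = All.tabulate λ {e} e∈ → Equivalence.to (es≡S e) e∈

  module _ {Done x y rest} (schedule : Schedule Done ((x , y) ∷ rest)) where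
    open Schedule schedule

    xy∈S : InS I (x , y)
    xy∈S = All.head rest⊆S

    done-not-above : ∀ {v w} → Done (v , w) → v ≤ x → y ≤ w → ⊥
    done-not-above {v} {w} vw-done v≤x y≤w with (v , w) ≟ (x , y)
    ... | yes refl = done∉rest vw-done (here refl)
    ... | no vw≢xy = longer⇒¬LengthLE v≤x (InS⇒≤ xy∈S) y≤w vw≢xy (done-first vw-done (here refl))

    inside-done : ∀ {a b} → InS I (a , b) → x ≤ a → b ≤ y → (a , b) ≢ (x , y) → Done (a , b)
    inside-done ab∈S x≤a b≤y ab≢xy with covers ab∈S
    ... | inj₁ ab-done = ab-done
    ... | inj₂ (here ab≡xy) = ⊥-elim (ab≢xy ab≡xy)
    ... | inj₂ (there ab∈rest) = ⊥-elim (longer⇒¬LengthLE x≤a (InS⇒≤ ab∈S) b≤y (λ eq → ab≢xy (sym eq))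
                                                          (All.lookup (AllPairs.head rest-sorted) ab∈rest))

    schedule-step : Schedule (Done ∪ ｛ x , y ｝) rest
    schedule-step = record
      { covers = λ q∈S → covers' (covers q∈S)
      ; done∉rest = λ { (inj₁ q-done) q∈rest → done∉rest q-done (there q∈rest)
                      ; (inj₂ refl) xy∈rest → All.lookup (AllPairs.head rest-unique) xy∈rest refl }
      ; done-first = λ { (inj₁ q-done) r∈rest → done-first q-done (there r∈rest)
                       ; (inj₂ refl) r∈rest → All.lookup (AllPairs.head rest-sorted) r∈rest }
      ; rest⊆S = All.tail rest⊆S
      ; rest-unique = AllPairs.tail rest-unique
      ; rest-sorted = AllPairs.tail rest-sorted
      }
      where
      covers' : ∀ {q} → Done q ⊎ q ∈ (x , y) ∷ rest → (Done ∪ ｛ x , y ｝) q ⊎ q ∈ rest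
      covers' (inj₁ q-done) = inj₁ (inj₁ q-done)
      covers' (inj₂ (here refl)) = inj₁ (inj₂ refl)
      covers' (inj₂ (there q∈rest)) = inj₂ q∈rest

  subdivided≅Bier : ∀ rest {Done K e} → Schedule Done rest → (M : Models K (Vertex Done) (Compatible Done)) →
                    (∀ {a} → Proper a → Models.g M (asInterval a) ≡ e a) → iterSd K e rest ≅ ΔBier L I
  subdivided≅Bier [] schedule M _ =
    models⇒≅ (models-transport M (final λ q∈S → [ (λ q-done → q-done) , (λ ()) ] (Schedule.covers schedule q∈S)))
  subdivided≅Bier ((x , y) ∷ rest) {Done} {K} {e} schedule M anchored =
    subst (λ F → iterSd (sd K F) (λ v → inj₁ (e v)) rest ≅ ΔBier L I) edge≡
      (subdivided≅Bier rest (schedule-step schedule) Step.models anchored')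
    where
    open SubdivideEdge Done (xy∈S schedule) (done-not-above schedule) (inside-done schedule)
    module Step = StellarModel _≟_ M subdivision
    edge≡ : Step.edge ≡ e x ∷ e y ∷ []
    edge≡ = cong₂ (λ a b → a ∷ b ∷ [])
      (anchored-at (asInterval-upper x∈I) x-proper) (anchored-at (asInterval-lower y∉I) y-proper)
      where
      anchored-at : ∀ {a q} → asInterval a ≡ q → Proper a → Models.g M q ≡ e a
      anchored-at refl = anchored
    anchored' : ∀ {a} → Proper a → Step.g' (asInterval a) ≡ inj₁ (e a)
    anchored' {a} Pa = trans (Step.g'-old (asInterval≢xy a)) (cong inj₁ (anchored Pa))

corollary2p5 : ∀ {n} (L : FinLattice n) (I : Subset n) → FinLattice.IsProperIdeal L I →
    (es : List (Fin n × Fin n)) →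
    (∀ e → (e ∈ es) ⇔ FinLattice.InS L I e) → Unique es →
    Linked (FinLattice.LengthLE L) es →
    SubdividedΔ L es ≅ ΔBier L I
corollary2p5 L I I-ideal es es≡S es-unique es-sorted =
  subdivided≅Bier es (schedule-start es≡S es-unique es-sorted)
    (models-transport (flag-models _ _) initial) (FlagIso.from∘to initial)
  where
  open Induction L I I-ideal
  open BierModel L I I-ideal
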